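{- Let $P$ be a functional Pure Type System. If $\Gamma\vdash t:B$ in $P$, then $\|\Gamma\|\vdash |t|:\|B\|$ in $\lambda\Pi_P$.
   Context: A Pure Type System $P=\langle S,A,R\rangle$ consists of a set $S$ of sorts, axioms $A\subseteq S\times S$ and rules $R\subseteq S\times S\times S$, with the usual PTS typing rules (conversion modulo $\beta$). $P$ is functional if $\langle s_1,s_2\rangle,\langle s_1,s_3\rangle\in A$ implies $s_2=s_3$ and $\langle s_1,s_2,s_3\rangle,\langle s_1,s_2,s_4\rangle\in R$ implies $s_3=s_4$. The $\lambda\Pi$-calculus modulo: terms $t::=x\mid Type\mid Kind\mid \Pi x:t~t\mid\lambda x:t~t\mid t~t$, typed by the $\lambda\Pi$-calculus rules (axiom $Type:Kind$, products $\langle Type,Type,Type\rangle$, $\langle Type,Kind,Kind\rangle$, corresponding abstractions, application), with conversion modulo the congruence generated by $\beta$ and given rewrite rules. $\Sigma_P$ declares, for each sort $s$, $U_s:Type$ and $\varepsilon_s:U_s\Rightarrow Type$; for each axiom $\langle s_1,s_2\rangle$, $\dot{s_1}:U_{s_2}$; for each rule $\langle s_1,s_2,s_3\rangle$, $\dot\Pi_{\langle s_1,s_2,s_3\rangle}:\Pi X:U_{s_1}~(((\varepsilon_{s_1}~X)\Rightarrow U_{s_2})\Rightarrow U_{s_3})$. Rewrite rules: $\varepsilon_{s_2}~\dot{s_1}\longrightarrow U_{s_1}$ (axioms) and $\varepsilon_{s_3}(\dot\Pi_{\langle s_1,s_2,s_3\rangle}~X~Y)\longrightarrow \Pi x:(\varepsilon_{s_1}~X)~(\varepsilon_{s_2}~(Y~x))$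 (rules). $\lambda\Pi_P$ is the $\lambda\Pi$-calculus modulo these rules and $\beta$; $\Gamma\vdash t:T$ in $\lambda\Pi_P$ means $\Sigma_P\Gamma\vdash t:T$. Translation of $t$ well-typed in $\Gamma$ in $P$: $|x|=x$; $|s|=\dot s$; $|\Pi x:A~B|=\dot\Pi_{\langle s_1,s_2,s_3\rangle}~|A|~(\lambda x:(\varepsilon_{s_1}~|A|)~|B|)$ with $s_1,s_2,s_3$ the types of $A$, $B$, $\Pi x:A~B$; $|\lambda x:A~t|=\lambda x:(\varepsilon_s~|A|)~|t|$ with $s$ the type of $A$; $|t~u|=|t|~|u|$. For $A$ of type a sort $s$, $\|A\|=\varepsilon_s~|A|$; for a non-typable sort $s'$, $\|s'\|=U_{s'}$. $\|[\,]\|=[\,]$, $\|\Gamma[x:A]\|=\|\Gamma\|[x:\|A\|]$. -}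

module Defs where

open import Data.Nat using (ℕ; zero; suc)
open import Data.Empty using (⊥)
open import Data.Product using (Σ; _×_; _,_)
open import Data.List using (List; []; _∷_)
open import Relation.Nullary using (¬_)
open import Relation.Binary.PropositionalEquality using (_≡_)
open import Relation.Binary.Construct.Closure.Equivalence using (EqClosure)

module Generic (Srt Con : Set) where

  data Term : Set where
    var   : ℕ → Term
    sort  : Srt → Term
    const : Con → Term
    pi    : Term → Term → Term      -- Π (binds var 0 in 2nd argument)
    lam   : Term → Term → Term      -- λ (binds var 0 in 2nd argument)
    app   : Term → Term → Term

  ext : (ℕ → ℕ) → ℕ → ℕ
  ext ρ zero    = zero
  ext ρ (suc n) = suc (ρ n)

  rename : (ℕ → ℕ) → Term → Term
  rename ρ (var n)   = var (ρ n)
  rename ρ (sort s)  = sort s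
  rename ρ (const c) = const c
  rename ρ (pi A B)  = pi (rename ρ A) (rename (ext ρ) B)
  rename ρ (lam A t) = lam (rename ρ A) (rename (ext ρ) t)
  rename ρ (app t u) = app (rename ρ t) (rename ρ u)

  shift : Term → Term
  shift = rename suc

  exts : (ℕ → Term) → ℕ → Term
  exts σ zero    = var zero
  exts σ (suc n) = shift (σ n)

  subst : (ℕ → Term) → Term → Term
  subst σ (var n)   = σ n
  subst σ (sort s)  = sort s
  subst σ (const c) = const c
  subst σ (pi A B)  = pi (subst σ A) (subst (exts σ) B)
  subst σ (lam A t) = lam (subst σ A) (subst (exts σ) t)
  subst σ (app t u) = app (subst σ t) (subst σ u)

  single : Term → ℕ → Term
  single u zero    = u
  single u (suc n) = var n

  _[_] : Term → Term → Term
  t [ u ] = subst (single u) t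

  -- contexts: head = most recently bound variable (index 0)
  Context : Set
  Context = List Term

  module Reduction (Rw : Term → Term → Set) where

    data _⟶_ : Term → Term → Set where
      beta : ∀ {A t u} → app (lam A t) u ⟶ (t [ u ])
      rw   : ∀ {t u} → Rw t u → t ⟶ u
      piˡ  : ∀ {A A' B} → A ⟶ A' → pi A B ⟶ pi A' B
      piʳ  : ∀ {A B B'} → B ⟶ B' → pi A B ⟶ pi A B'
      lamˡ : ∀ {A A' t} → A ⟶ A' → lam A t ⟶ lam A' t
      lamʳ : ∀ {A t t'} → t ⟶ t' → lam A t ⟶ lam A t'
      appˡ : ∀ {t t' u} → t ⟶ t' → app t u ⟶ app t' u
      appʳ : ∀ {t u u'} → u ⟶ u' → app t u ⟶ app t u'

    _≃_ : Term → Term → Set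
    _≃_ = EqClosure _⟶_

  module Typing (Ax : Srt → Srt → Set) (Rl : Srt → Srt → Srt → Set)
                (Decl : Con → Term → Set) (_≃_ : Term → Term → Set) where

    data _⊢_∶_ : Context → Term → Term → Set where
      axiom : ∀ {s₁ s₂} → Ax s₁ s₂ → [] ⊢ sort s₁ ∶ sort s₂
      const : ∀ {c A s} → Decl c A → [] ⊢ A ∶ sort s → [] ⊢ const c ∶ A
      start : ∀ {Γ A s} → Γ ⊢ A ∶ sort s → (A ∷ Γ) ⊢ var zero ∶ shift A
      weak  : ∀ {Γ t T A s} → Γ ⊢ t ∶ T → Γ ⊢ A ∶ sort s →
              (A ∷ Γ) ⊢ shift t ∶ shift T
      prod  : ∀ {Γ A B s₁ s₂ s₃} → Rl s₁ s₂ s₃ → Γ ⊢ A ∶ sort s₁ →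
              (A ∷ Γ) ⊢ B ∶ sort s₂ → Γ ⊢ pi A B ∶ sort s₃
      abs   : ∀ {Γ A B t s} → (A ∷ Γ) ⊢ t ∶ B → Γ ⊢ pi A B ∶ sort s →
              Γ ⊢ lam A t ∶ pi A B
      appl  : ∀ {Γ t u A B} → Γ ⊢ t ∶ pi A B → Γ ⊢ u ∶ A →
              Γ ⊢ app t u ∶ (B [ u ])
      conv  : ∀ {Γ t A B s} → Γ ⊢ t ∶ A → Γ ⊢ B ∶ sort s → A ≃ B →
              Γ ⊢ t ∶ B

data LSort : Set where
  type kind : LSort

data LAx : LSort → LSort → Set where
  type:kind : LAx type kind

data LRl : LSort → LSort → LSort → Set where
  ttt : LRl type type type
  tkk : LRl type kind kind

module PTS (S : Set) (Ax : S → S → Set) (Rl : S → S → S → Set) where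

  Functional : Set
  Functional =
    (∀ {s₁ s₂ s₃} → Ax s₁ s₂ → Ax s₁ s₃ → s₂ ≡ s₃) ×
    (∀ {s₁ s₂ s₃ s₄} → Rl s₁ s₂ s₃ → Rl s₁ s₂ s₄ → s₃ ≡ s₄)

  module P = Generic S ⊥

  noRw : P.Term → P.Term → Set
  noRw _ _ = ⊥

  noDecl : ⊥ → P.Term → Set
  noDecl ()

  module PRed = P.Reduction noRw
  module PTy  = P.Typing Ax Rl noDecl PRed._≃_

  _⊢_∶_ : P.Context → P.Term → P.Term → Set
  _⊢_∶_ = PTy._⊢_∶_

  data Const : Set where
    U     : S → Const
    ε     : S → Const
    dot   : S → Const
    dotΠ  : S → S → S → Const

  module L = Generic LSort Const
  open L using (var; sort; const; pi; lam; app)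

  data Decl : Const → L.Term → Set where
    declU   : ∀ {s} → Decl (U s) (sort type)
    declε   : ∀ {s} → Decl (ε s) (pi (const (U s)) (sort type))
    decldot : ∀ {s₁ s₂} → Ax s₁ s₂ → Decl (dot s₁) (const (U s₂))
    declΠ   : ∀ {s₁ s₂ s₃} → Rl s₁ s₂ s₃ →
              Decl (dotΠ s₁ s₂ s₃)
                   (pi (const (U s₁))
                       (pi (pi (app (const (ε s₁)) (var 0)) (const (U s₂)))
                           (const (U s₃))))

  data Rw : L.Term → L.Term → Set where
    rwAx : ∀ {s₁ s₂} → Ax s₁ s₂ →
           Rw (app (const (ε s₂)) (const (dot s₁))) (const (U s₁))
    rwRl : ∀ {s₁ s₂ s₃} → Rl s₁ s₂ s₃ → ∀ X Y →
           Rw (app (const (ε s₃)) (app (app (const (dotΠ s₁ s₂ s₃)) X) Y))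
              (pi (app (const (ε s₁)) X)
                  (app (const (ε s₂)) (app (L.shift Y) (var 0))))

  module LRed = L.Reduction Rw
  module LTy  = L.Typing LAx LRl Decl LRed._≃_

  _⊢λΠ_∶_ : L.Context → L.Term → L.Term → Set
  _⊢λΠ_∶_ = LTy._⊢_∶_

  -- translation |t| (relative to the context Γ in which t is typed in P);
  -- the sorts used are the types of the relevant subterms in P
  data Tr : P.Context → P.Term → L.Term → Set where
    var  : ∀ {Γ n} → Tr Γ (P.var n) (var n)
    sort : ∀ {Γ s} → Tr Γ (P.sort s) (const (dot s))
    pi   : ∀ {Γ A B A' B' s₁ s₂ s₃} →
           Γ ⊢ A ∶ P.sort s₁ → (A ∷ Γ) ⊢ B ∶ P.sort s₂ →
           Γ ⊢ P.pi A B ∶ P.sort s₃ →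
           Tr Γ A A' → Tr (A ∷ Γ) B B' →
           Tr Γ (P.pi A B)
              (app (app (const (dotΠ s₁ s₂ s₃)) A')
                   (lam (app (const (ε s₁)) A') B'))
    lam  : ∀ {Γ A t A' t' s} →
           Γ ⊢ A ∶ P.sort s → Tr Γ A A' → Tr (A ∷ Γ) t t' →
           Tr Γ (P.lam A t) (lam (app (const (ε s)) A') t')
    app  : ∀ {Γ t u t' u'} → Tr Γ t t' → Tr Γ u u' →
           Tr Γ (P.app t u) (app t' u')

  data TrType : P.Context → P.Term → L.Term → Set where
    typed : ∀ {Γ A A' s} → Γ ⊢ A ∶ P.sort s → Tr Γ A A' →
            TrType Γ A (app (const (ε s)) A')
    top   : ∀ {Γ s} → ¬ Σ S (Ax s) → TrType Γ (P.sort s) (const (U s))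

  data TrCtx : P.Context → L.Context → Set where
    []  : TrCtx [] []
    _∷_ : ∀ {Γ Γ' A A'} → TrType Γ A A' → TrCtx Γ Γ' → TrCtx (A ∷ Γ) (A' ∷ Γ')

-- Because P is functional, every term has a unique type up to conversion, so the sorts that
-- annotate |t| depend only on t and its context; hence translation commutes with renaming and
-- substitution, and a source β-step becomes a target β-step. By confluence and subject
-- reduction, convertible types then have convertible translations, the axiom rule
-- ε_{s₂} ṡ₁ ⟶ U_{s₁} accounting for sorts. The theorem follows by induction on a derivation:
-- products are typed through Π̇, and ε_{s₃} (Π̇ A B) ⟶ Π x : ε A. ε (B x) gives abstractions
-- and applications their types.
{-# OPTIONS --safe #-}
module Submission where

open import Data.Nat using (ℕ; zero; suc)
open import Data.Empty using (⊥)
open import Data.Product using (∃; _×_; _,_; proj₁; proj₂)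
open import Data.Sum using (_⊎_; inj₁; inj₂)
open import Data.List using ([]; _∷_)
open import Function using (_∘_; id)
open import Relation.Binary.PropositionalEquality
  using (_≡_; _≗_; refl; sym; trans; cong; cong₂; module ≡-Reasoning)
  renaming (subst to transport; subst₂ to transport₂)
import Relation.Binary.Construct.Closure.ReflexiveTransitive as Star
open Star using (Star; _◅_; _◅◅_)
import Relation.Binary.Construct.Closure.Symmetric as Sym
import Relation.Binary.Construct.Closure.Equivalence as EqClosure
open import Defs

-- Substitution calculus

module Substitution (Srt Con : Set) where
  open Generic Srt Con

  ext-cong : ∀ {ρ ρ'} → ρ ≗ ρ' → ext ρ ≗ ext ρ'
  ext-cong h zero    = refl
  ext-cong h (suc n) = cong suc (h n)

  rename-cong : ∀ {ρ ρ'} → ρ ≗ ρ' → rename ρ ≗ rename ρ'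
  rename-cong h (var n)   = cong var (h n)
  rename-cong h (sort s)  = refl
  rename-cong h (const c) = refl
  rename-cong h (pi A B)  = cong₂ pi (rename-cong h A) (rename-cong (ext-cong h) B)
  rename-cong h (lam A t) = cong₂ lam (rename-cong h A) (rename-cong (ext-cong h) t)
  rename-cong h (app t u) = cong₂ app (rename-cong h t) (rename-cong h u)

  ext-∘ : ∀ ρ ρ' → ext ρ ∘ ext ρ' ≗ ext (ρ ∘ ρ')
  ext-∘ ρ ρ' zero    = refl
  ext-∘ ρ ρ' (suc n) = refl

  rename-∘ : ∀ ρ ρ' → rename ρ ∘ rename ρ' ≗ rename (ρ ∘ ρ')
  rename-∘ ρ ρ' (var n)   = refl
  rename-∘ ρ ρ' (sort s)  = refl
  rename-∘ ρ ρ' (const c) = refl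
  rename-∘ ρ ρ' (pi A B)  =
    cong₂ pi (rename-∘ ρ ρ' A) (trans (rename-∘ (ext ρ) (ext ρ') B) (rename-cong (ext-∘ ρ ρ') B))
  rename-∘ ρ ρ' (lam A t) =
    cong₂ lam (rename-∘ ρ ρ' A) (trans (rename-∘ (ext ρ) (ext ρ') t) (rename-cong (ext-∘ ρ ρ') t))
  rename-∘ ρ ρ' (app t u) = cong₂ app (rename-∘ ρ ρ' t) (rename-∘ ρ ρ' u)

  rename-ext-shift : ∀ ρ A → rename (ext ρ) (shift A) ≡ shift (rename ρ A)
  rename-ext-shift ρ A = trans (rename-∘ (ext ρ) suc A) (sym (rename-∘ suc ρ A))

  exts-cong : ∀ {σ τ} → σ ≗ τ → exts σ ≗ exts τ
  exts-cong h zero    = refl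
  exts-cong h (suc n) = cong shift (h n)

  subst-cong : ∀ {σ τ} → σ ≗ τ → subst σ ≗ subst τ
  subst-cong h (var n)   = h n
  subst-cong h (sort s)  = refl
  subst-cong h (const c) = refl
  subst-cong h (pi A B)  = cong₂ pi (subst-cong h A) (subst-cong (exts-cong h) B)
  subst-cong h (lam A t) = cong₂ lam (subst-cong h A) (subst-cong (exts-cong h) t)
  subst-cong h (app t u) = cong₂ app (subst-cong h t) (subst-cong h u)

  rename-ext-exts : ∀ ρ σ → rename (ext ρ) ∘ exts σ ≗ exts (rename ρ ∘ σ)
  rename-ext-exts ρ σ zero    = refl
  rename-ext-exts ρ σ (suc n) = rename-ext-shift ρ (σ n)

  rename-subst : ∀ ρ σ → rename ρ ∘ subst σ ≗ subst (rename ρ ∘ σ)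
  rename-subst ρ σ (var n)   = refl
  rename-subst ρ σ (sort s)  = refl
  rename-subst ρ σ (const c) = refl
  rename-subst ρ σ (pi A B)  =
    cong₂ pi (rename-subst ρ σ A)
             (trans (rename-subst (ext ρ) (exts σ) B) (subst-cong (rename-ext-exts ρ σ) B))
  rename-subst ρ σ (lam A t) =
    cong₂ lam (rename-subst ρ σ A)
              (trans (rename-subst (ext ρ) (exts σ) t) (subst-cong (rename-ext-exts ρ σ) t))
  rename-subst ρ σ (app t u) = cong₂ app (rename-subst ρ σ t) (rename-subst ρ σ u)

  exts-ext : ∀ σ ρ → exts σ ∘ ext ρ ≗ exts (σ ∘ ρ)
  exts-ext σ ρ zero    = refl
  exts-ext σ ρ (suc n) = refl

  subst-rename : ∀ σ ρ → subst σ ∘ rename ρ ≗ subst (σ ∘ ρ)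
  subst-rename σ ρ (var n)   = refl
  subst-rename σ ρ (sort s)  = refl
  subst-rename σ ρ (const c) = refl
  subst-rename σ ρ (pi A B)  =
    cong₂ pi (subst-rename σ ρ A)
             (trans (subst-rename (exts σ) (ext ρ) B) (subst-cong (exts-ext σ ρ) B))
  subst-rename σ ρ (lam A t) =
    cong₂ lam (subst-rename σ ρ A)
              (trans (subst-rename (exts σ) (ext ρ) t) (subst-cong (exts-ext σ ρ) t))
  subst-rename σ ρ (app t u) = cong₂ app (subst-rename σ ρ t) (subst-rename σ ρ u)

  subst-exts-shift : ∀ σ A → subst (exts σ) (shift A) ≡ shift (subst σ A)
  subst-exts-shift σ A = trans (subst-rename (exts σ) suc A) (sym (rename-subst suc σ A))

  subst-exts-exts : ∀ σ τ → subst (exts σ) ∘ exts τ ≗ exts (subst σ ∘ τ)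
  subst-exts-exts σ τ zero    = refl
  subst-exts-exts σ τ (suc n) = subst-exts-shift σ (τ n)

  subst-∘ : ∀ σ τ → subst σ ∘ subst τ ≗ subst (subst σ ∘ τ)
  subst-∘ σ τ (var n)   = refl
  subst-∘ σ τ (sort s)  = refl
  subst-∘ σ τ (const c) = refl
  subst-∘ σ τ (pi A B)  =
    cong₂ pi (subst-∘ σ τ A)
             (trans (subst-∘ (exts σ) (exts τ) B) (subst-cong (subst-exts-exts σ τ) B))
  subst-∘ σ τ (lam A t) =
    cong₂ lam (subst-∘ σ τ A)
              (trans (subst-∘ (exts σ) (exts τ) t) (subst-cong (subst-exts-exts σ τ) t))
  subst-∘ σ τ (app t u) = cong₂ app (subst-∘ σ τ t) (subst-∘ σ τ u)

  exts-var : exts var ≗ var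
  exts-var zero    = refl
  exts-var (suc n) = refl

  subst-id : subst var ≗ id
  subst-id (var n)   = refl
  subst-id (sort s)  = refl
  subst-id (const c) = refl
  subst-id (pi A B)  = cong₂ pi (subst-id A) (trans (subst-cong exts-var B) (subst-id B))
  subst-id (lam A t) = cong₂ lam (subst-id A) (trans (subst-cong exts-var t) (subst-id t))
  subst-id (app t u) = cong₂ app (subst-id t) (subst-id u)

  shift-[] : ∀ t u → shift t [ u ] ≡ t
  shift-[] t u = trans (subst-rename (single u) suc t) (subst-id t)

  subst-[] : ∀ σ t u → subst σ (t [ u ]) ≡ subst (exts σ) t [ subst σ u ]
  subst-[] σ t u = begin
    subst σ (t [ u ])                               ≡⟨ subst-∘ σ (single u) t ⟩
    subst (subst σ ∘ single u) t                    ≡⟨ subst-cong commute t ⟩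
    subst (subst (single (subst σ u)) ∘ exts σ) t   ≡⟨ subst-∘ (single (subst σ u)) (exts σ) t ⟨
    subst (exts σ) t [ subst σ u ]                  ∎
    where
    open ≡-Reasoning
    commute : subst σ ∘ single u ≗ subst (single (subst σ u)) ∘ exts σ
    commute zero    = refl
    commute (suc n) = sym (shift-[] (σ n) (subst σ u))

  rename-[] : ∀ ρ t u → rename ρ (t [ u ]) ≡ rename (ext ρ) t [ rename ρ u ]
  rename-[] ρ t u = begin
    rename ρ (t [ u ])                              ≡⟨ rename-subst ρ (single u) t ⟩
    subst (rename ρ ∘ single u) t                   ≡⟨ subst-cong commute t ⟩
    subst (single (rename ρ u) ∘ ext ρ) t           ≡⟨ subst-rename (single (rename ρ u)) (ext ρ) t ⟨
    rename (ext ρ) t [ rename ρ u ]                 ∎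
    where
    open ≡-Reasoning
    commute : rename ρ ∘ single u ≗ single (rename ρ u) ∘ ext ρ
    commute zero    = refl
    commute (suc n) = refl

  rename-ext-suc-[var0] : ∀ t → rename (ext suc) t [ var zero ] ≡ t
  rename-ext-suc-[var0] t =
    trans (subst-rename (single (var zero)) (ext suc) t)
          (trans (subst-cong var-fixed t) (subst-id t))
    where
    var-fixed : single (var zero) ∘ ext suc ≗ var
    var-fixed zero    = refl
    var-fixed (suc n) = refl

-- Confluence of β-reduction, by parallel reduction and complete developments

module ParallelReduction (Srt Con : Set) where
  open Generic Srt Con
  open Substitution Srt Con

  infix 4 _⇛_ _⇛*_
  data _⇛_ : Term → Term → Set where
    pvar   : ∀ {n} → var n ⇛ var n
    psort  : ∀ {s} → sort s ⇛ sort s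
    pconst : ∀ {c} → const c ⇛ const c
    ppi    : ∀ {A A' B B'} → A ⇛ A' → B ⇛ B' → pi A B ⇛ pi A' B'
    plam   : ∀ {A A' t t'} → A ⇛ A' → t ⇛ t' → lam A t ⇛ lam A' t'
    papp   : ∀ {t t' u u'} → t ⇛ t' → u ⇛ u' → app t u ⇛ app t' u'
    pbeta  : ∀ {A t t' u u'} → t ⇛ t' → u ⇛ u' → app (lam A t) u ⇛ t' [ u' ]

  _⇛*_ : Term → Term → Set
  _⇛*_ = Star _⇛_

  ⇛-refl : ∀ t → t ⇛ t
  ⇛-refl (var n)   = pvar
  ⇛-refl (sort s)  = psort
  ⇛-refl (const c) = pconst
  ⇛-refl (pi A B)  = ppi (⇛-refl A) (⇛-refl B)
  ⇛-refl (lam A t) = plam (⇛-refl A) (⇛-refl t)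
  ⇛-refl (app t u) = papp (⇛-refl t) (⇛-refl u)

  ⇛-rename : ∀ ρ {t t'} → t ⇛ t' → rename ρ t ⇛ rename ρ t'
  ⇛-rename ρ pvar       = pvar
  ⇛-rename ρ psort      = psort
  ⇛-rename ρ pconst     = pconst
  ⇛-rename ρ (ppi p q)  = ppi (⇛-rename ρ p) (⇛-rename (ext ρ) q)
  ⇛-rename ρ (plam p q) = plam (⇛-rename ρ p) (⇛-rename (ext ρ) q)
  ⇛-rename ρ (papp p q) = papp (⇛-rename ρ p) (⇛-rename ρ q)
  ⇛-rename ρ (pbeta {t' = t'} {u' = u'} p q) =
    transport (_ ⇛_) (sym (rename-[] ρ t' u')) (pbeta (⇛-rename (ext ρ) p) (⇛-rename ρ q))

  ⇛-exts : ∀ {σ τ} → (∀ n → σ n ⇛ τ n) → ∀ n → exts σ n ⇛ exts τ n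
  ⇛-exts h zero    = pvar
  ⇛-exts h (suc n) = ⇛-rename suc (h n)

  ⇛-subst : ∀ {σ τ} → (∀ n → σ n ⇛ τ n) → ∀ {t t'} → t ⇛ t' → subst σ t ⇛ subst τ t'
  ⇛-subst h (pvar {n}) = h n
  ⇛-subst h psort      = psort
  ⇛-subst h pconst     = pconst
  ⇛-subst h (ppi p q)  = ppi (⇛-subst h p) (⇛-subst (⇛-exts h) q)
  ⇛-subst h (plam p q) = plam (⇛-subst h p) (⇛-subst (⇛-exts h) q)
  ⇛-subst h (papp p q) = papp (⇛-subst h p) (⇛-subst h q)
  ⇛-subst {τ = τ} h (pbeta {t' = t'} {u' = u'} p q) =
    transport (_ ⇛_) (sym (subst-[] τ t' u')) (pbeta (⇛-subst (⇛-exts h) p) (⇛-subst h q))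

  ⇛-single : ∀ {u u'} → u ⇛ u' → ∀ n → single u n ⇛ single u' n
  ⇛-single p zero    = p
  ⇛-single p (suc n) = pvar

  develop : Term → Term
  develop (var n)              = var n
  develop (sort s)             = sort s
  develop (const c)            = const c
  develop (pi A B)             = pi (develop A) (develop B)
  develop (lam A t)            = lam (develop A) (develop t)
  develop (app (lam A t) u)    = develop t [ develop u ]
  develop (app (var n) u)      = app (var n) (develop u)
  develop (app (sort s) u)     = app (sort s) (develop u)
  develop (app (const c) u)    = app (const c) (develop u)
  develop (app (pi A B) u)     = app (develop (pi A B)) (develop u)
  develop (app (app t v) u)    = app (develop (app t v)) (develop u)

  develop-triangle : ∀ {t t'} → t ⇛ t' → t' ⇛ develop t
  develop-triangle pvar                    = pvar
  develop-triangle psort                   = psort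
  develop-triangle pconst                  = pconst
  develop-triangle (ppi p q)               = ppi (develop-triangle p) (develop-triangle q)
  develop-triangle (plam p q)              = plam (develop-triangle p) (develop-triangle q)
  develop-triangle (pbeta p q)             = ⇛-subst (⇛-single (develop-triangle q)) (develop-triangle p)
  develop-triangle (papp (plam p r) q)     = pbeta (develop-triangle r) (develop-triangle q)
  develop-triangle (papp {t = var n} p q)  = papp (develop-triangle p) (develop-triangle q)
  develop-triangle (papp {t = sort s} p q) = papp (develop-triangle p) (develop-triangle q)
  develop-triangle (papp {t = const c} p q) = papp (develop-triangle p) (develop-triangle q)
  develop-triangle (papp {t = pi A B} p q) = papp (develop-triangle p) (develop-triangle q)
  develop-triangle (papp {t = app t v} p q) = papp (develop-triangle p) (develop-triangle q)

  strip : ∀ {a b c} → a ⇛ b → a ⇛* c → ∃ λ d → b ⇛* d × c ⇛ d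
  strip {b = b} p Star.ε = b , Star.ε , p
  strip p (q ◅ qs) with strip (develop-triangle q) qs
  ... | d , b⇛*d , c⇛d = d , develop-triangle p ◅ b⇛*d , c⇛d

  ⇛*-confluent : ∀ {a b c} → a ⇛* b → a ⇛* c → ∃ λ d → b ⇛* d × c ⇛* d
  ⇛*-confluent {c = c} Star.ε qs = c , qs , Star.ε
  ⇛*-confluent (p ◅ ps) qs with strip p qs
  ... | d , b⇛*d , c⇛d with ⇛*-confluent ps b⇛*d
  ... | e , b'⇛*e , d⇛*e = e , b'⇛*e , c⇛d ◅ d⇛*e

-- Metatheory of the source PTS

module Metatheory (S : Set) (Ax : S → S → Set) (Rl : S → S → S → Set) where
  open PTS S Ax Rl
  open P
    using (Term; Context; var; sort; pi; lam; app; rename; shift; subst; exts; ext; single; _[_])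
  open Substitution S ⊥
  open ParallelReduction S ⊥
  open PRed using (_⟶_; _≃_; beta; rw; piˡ; piʳ; lamˡ; lamʳ; appˡ; appʳ)

  infix 4 _⟶*_
  _⟶*_ : Term → Term → Set
  _⟶*_ = Star _⟶_

  ≃-sym : ∀ {a b} → a ≃ b → b ≃ a
  ≃-sym = EqClosure.symmetric _⟶_

  ≃-trans : ∀ {a b c} → a ≃ b → b ≃ c → a ≃ c
  ≃-trans = EqClosure.transitive _⟶_

  ⟶*⇒≃ : ∀ {a b} → a ⟶* b → a ≃ b
  ⟶*⇒≃ = Star.map Sym.fwd

  ⟶*-pi : ∀ {A A' B B'} → A ⟶* A' → B ⟶* B' → pi A B ⟶* pi A' B'
  ⟶*-pi p q = Star.gmap _ piˡ p ◅◅ Star.gmap _ piʳ q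

  ⟶*-lam : ∀ {A A' t t'} → A ⟶* A' → t ⟶* t' → lam A t ⟶* lam A' t'
  ⟶*-lam p q = Star.gmap _ lamˡ p ◅◅ Star.gmap _ lamʳ q

  ⟶*-app : ∀ {t t' u u'} → t ⟶* t' → u ⟶* u' → app t u ⟶* app t' u'
  ⟶*-app p q = Star.gmap _ appˡ p ◅◅ Star.gmap _ appʳ q

  ⟶⇒⇛ : ∀ {a b} → a ⟶ b → a ⇛ b
  ⟶⇒⇛ (beta {t = t} {u})   = pbeta (⇛-refl t) (⇛-refl u)
  ⟶⇒⇛ (rw ())
  ⟶⇒⇛ (piˡ {B = B} s)      = ppi (⟶⇒⇛ s) (⇛-refl B)
  ⟶⇒⇛ (piʳ {A = A} s)      = ppi (⇛-refl A) (⟶⇒⇛ s)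
  ⟶⇒⇛ (lamˡ {t = t} s)     = plam (⟶⇒⇛ s) (⇛-refl t)
  ⟶⇒⇛ (lamʳ {A = A} s)     = plam (⇛-refl A) (⟶⇒⇛ s)
  ⟶⇒⇛ (appˡ {u = u} s)     = papp (⟶⇒⇛ s) (⇛-refl u)
  ⟶⇒⇛ (appʳ {t = t} s)     = papp (⇛-refl t) (⟶⇒⇛ s)

  ⇛⇒⟶* : ∀ {a b} → a ⇛ b → a ⟶* b
  ⇛⇒⟶* pvar        = Star.ε
  ⇛⇒⟶* psort       = Star.ε
  ⇛⇒⟶* pconst      = Star.ε
  ⇛⇒⟶* (ppi p q)   = ⟶*-pi (⇛⇒⟶* p) (⇛⇒⟶* q)
  ⇛⇒⟶* (plam p q)  = ⟶*-lam (⇛⇒⟶* p) (⇛⇒⟶* q)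
  ⇛⇒⟶* (papp p q)  = ⟶*-app (⇛⇒⟶* p) (⇛⇒⟶* q)
  ⇛⇒⟶* (pbeta p q) = ⟶*-app (⟶*-lam Star.ε (⇛⇒⟶* p)) (⇛⇒⟶* q) ◅◅ Star.return beta

  ⟶*-confluent : ∀ {a b c} → a ⟶* b → a ⟶* c → ∃ λ d → b ⟶* d × c ⟶* d
  ⟶*-confluent p q with ⇛*-confluent (Star.map ⟶⇒⇛ p) (Star.map ⟶⇒⇛ q)
  ... | d , b⇛*d , c⇛*d = d , (⇛⇒⟶* Star.⋆) b⇛*d , (⇛⇒⟶* Star.⋆) c⇛*d

  church-rosser : ∀ {a b} → a ≃ b → ∃ λ d → a ⟶* d × b ⟶* d
  church-rosser {a} Star.ε = a , Star.ε , Star.ε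
  church-rosser (Sym.fwd s ◅ rest) with church-rosser rest
  ... | d , b⟶*d , c⟶*d = d , s ◅ b⟶*d , c⟶*d
  church-rosser (Sym.bwd s ◅ rest) with church-rosser rest
  ... | d , b⟶*d , c⟶*d with ⟶*-confluent (Star.return s) b⟶*d
  ... | e , a⟶*e , d⟶*e = e , a⟶*e , c⟶*d ◅◅ d⟶*e

  sort-⟶* : ∀ {s t} → sort s ⟶* t → t ≡ sort s
  sort-⟶* Star.ε         = refl
  sort-⟶* (rw () ◅ _)

  record PiReduct (A B t : Term) : Set where
    constructor piReduct
    field
      {A₁ B₁} : Term
      ≡pi     : t ≡ pi A₁ B₁
      A⟶*A₁   : A ⟶* A₁
      B⟶*B₁   : B ⟶* B₁

  pi-⟶* : ∀ {A B t} → pi A B ⟶* t → PiReduct A B t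
  pi-⟶* Star.ε = piReduct refl Star.ε Star.ε
  pi-⟶* (rw () ◅ _)
  pi-⟶* (piˡ s ◅ r) with pi-⟶* r
  ... | piReduct eq p q = piReduct eq (s ◅ p) q
  pi-⟶* (piʳ s ◅ r) with pi-⟶* r
  ... | piReduct eq p q = piReduct eq p (s ◅ q)

  sort-injective : ∀ {s s'} → sort s ≃ sort s' → s ≡ s'
  sort-injective c with church-rosser c
  ... | d , p , q with trans (sym (sort-⟶* p)) (sort-⟶* q)
  ... | refl = refl

  pi-injective : ∀ {A B A' B'} → pi A B ≃ pi A' B' → A ≃ A' × B ≃ B'
  pi-injective c with church-rosser c
  ... | d , p , q with pi-⟶* p | pi-⟶* q
  ... | piReduct refl pA pB | piReduct refl qA qB =
    ≃-trans (⟶*⇒≃ pA) (≃-sym (⟶*⇒≃ qA)) , ≃-trans (⟶*⇒≃ pB) (≃-sym (⟶*⇒≃ qB))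

  ⟶-rename : ∀ ρ {a b} → a ⟶ b → rename ρ a ⟶ rename ρ b
  ⟶-rename ρ (beta {A} {t} {u}) =
    transport (rename ρ (app (lam A t) u) ⟶_) (sym (rename-[] ρ t u)) beta
  ⟶-rename ρ (rw ())
  ⟶-rename ρ (piˡ s)  = piˡ (⟶-rename ρ s)
  ⟶-rename ρ (piʳ s)  = piʳ (⟶-rename (ext ρ) s)
  ⟶-rename ρ (lamˡ s) = lamˡ (⟶-rename ρ s)
  ⟶-rename ρ (lamʳ s) = lamʳ (⟶-rename (ext ρ) s)
  ⟶-rename ρ (appˡ s) = appˡ (⟶-rename ρ s)
  ⟶-rename ρ (appʳ s) = appʳ (⟶-rename ρ s)

  ⟶-subst : ∀ σ {a b} → a ⟶ b → subst σ a ⟶ subst σ b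
  ⟶-subst σ (beta {A} {t} {u}) =
    transport (subst σ (app (lam A t) u) ⟶_) (sym (subst-[] σ t u)) beta
  ⟶-subst σ (rw ())
  ⟶-subst σ (piˡ s)  = piˡ (⟶-subst σ s)
  ⟶-subst σ (piʳ s)  = piʳ (⟶-subst (exts σ) s)
  ⟶-subst σ (lamˡ s) = lamˡ (⟶-subst σ s)
  ⟶-subst σ (lamʳ s) = lamʳ (⟶-subst (exts σ) s)
  ⟶-subst σ (appˡ s) = appˡ (⟶-subst σ s)
  ⟶-subst σ (appʳ s) = appʳ (⟶-subst σ s)

  ≃-rename : ∀ ρ {a b} → a ≃ b → rename ρ a ≃ rename ρ b
  ≃-rename ρ = EqClosure.gmap (rename ρ) (⟶-rename ρ)

  ≃-subst : ∀ σ {a b} → a ≃ b → subst σ a ≃ subst σ b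
  ≃-subst σ = EqClosure.gmap (subst σ) (⟶-subst σ)

  []-⟶* : ∀ B {u u'} → u ⟶ u' → B [ u ] ⟶* B [ u' ]
  []-⟶* B s = ⇛⇒⟶* (⇛-subst (⇛-single (⟶⇒⇛ s)) (⇛-refl B))

  infix 4 _∋_∶_ _⊩_∶_

  data _∋_∶_ : Context → ℕ → Term → Set where
    here  : ∀ {Γ A} → (A ∷ Γ) ∋ zero ∶ shift A
    there : ∀ {Γ A n T} → Γ ∋ n ∶ T → (A ∷ Γ) ∋ suc n ∶ shift T

  ∋-functional : ∀ {Γ n T T'} → Γ ∋ n ∶ T → Γ ∋ n ∶ T' → T ≡ T'
  ∋-functional here      here      = refl
  ∋-functional (there x) (there y) = cong shift (∋-functional x y)

  -- ⊢ with explicitly well-formed contexts and with the sorts of domain and codomain recorded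
  -- in abs and appl: equivalent to ⊢, but closed under weakening and substitution by plain
  -- structural induction.
  data WF : Context → Set
  data _⊩_∶_ : Context → Term → Term → Set

  data WF where
    []  : WF []
    _∷_ : ∀ {Γ A s} → WF Γ → Γ ⊩ A ∶ sort s → WF (A ∷ Γ)

  data _⊩_∶_ where
    var   : ∀ {Γ n T} → WF Γ → Γ ∋ n ∶ T → Γ ⊩ var n ∶ T
    axiom : ∀ {Γ s₁ s₂} → WF Γ → Ax s₁ s₂ → Γ ⊩ sort s₁ ∶ sort s₂
    prod  : ∀ {Γ A B s₁ s₂ s₃} → Rl s₁ s₂ s₃ → Γ ⊩ A ∶ sort s₁ → (A ∷ Γ) ⊩ B ∶ sort s₂ →
            Γ ⊩ pi A B ∶ sort s₃
    abs   : ∀ {Γ A B t s₁ s₂ s₃} → Rl s₁ s₂ s₃ → Γ ⊩ A ∶ sort s₁ → (A ∷ Γ) ⊩ B ∶ sort s₂ →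
            (A ∷ Γ) ⊩ t ∶ B → Γ ⊩ lam A t ∶ pi A B
    appl  : ∀ {Γ A B t u s₁ s₂ s₃} → Rl s₁ s₂ s₃ → Γ ⊩ A ∶ sort s₁ → (A ∷ Γ) ⊩ B ∶ sort s₂ →
            Γ ⊩ t ∶ pi A B → Γ ⊩ u ∶ A → Γ ⊩ app t u ∶ B [ u ]
    conv  : ∀ {Γ t A B s} → Γ ⊩ t ∶ A → Γ ⊩ B ∶ sort s → A ≃ B → Γ ⊩ t ∶ B

  ⊩-wf : ∀ {Γ t T} → Γ ⊩ t ∶ T → WF Γ
  ⊩-wf (var w x)        = w
  ⊩-wf (axiom w a)      = w
  ⊩-wf (prod r d e)     = ⊩-wf d
  ⊩-wf (abs r d e f)    = ⊩-wf d
  ⊩-wf (appl r d e f g) = ⊩-wf d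
  ⊩-wf (conv d e c)     = ⊩-wf d

  Ren : Context → (ℕ → ℕ) → Context → Set
  Ren Δ ρ Γ = ∀ {n T} → Γ ∋ n ∶ T → Δ ∋ ρ n ∶ rename ρ T

  Ren-ext : ∀ {Γ Δ ρ A} → Ren Δ ρ Γ → Ren (rename ρ A ∷ Δ) (ext ρ) (A ∷ Γ)
  Ren-ext {Δ = Δ} {ρ} {A} r here =
    transport (rename ρ A ∷ Δ ∋ zero ∶_) (sym (rename-ext-shift ρ A)) here
  Ren-ext {ρ = ρ} r (there {T = T} x) =
    transport (_ ∋ _ ∶_) (sym (rename-ext-shift ρ T)) (there (r x))

  ⊩-rename : ∀ {Γ Δ ρ t T} → Γ ⊩ t ∶ T → Ren Δ ρ Γ → WF Δ → Δ ⊩ rename ρ t ∶ rename ρ T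
  ⊩-rename (var w x) r wΔ     = var wΔ (r x)
  ⊩-rename (axiom w a) r wΔ   = axiom wΔ a
  ⊩-rename (prod rl dA dB) r wΔ =
    let dA' = ⊩-rename dA r wΔ in prod rl dA' (⊩-rename dB (Ren-ext r) (wΔ ∷ dA'))
  ⊩-rename (abs rl dA dB dt) r wΔ =
    let dA' = ⊩-rename dA r wΔ
    in abs rl dA' (⊩-rename dB (Ren-ext r) (wΔ ∷ dA')) (⊩-rename dt (Ren-ext r) (wΔ ∷ dA'))
  ⊩-rename {ρ = ρ} (appl {B = B} {u = u} rl dA dB dt du) r wΔ =
    let dA' = ⊩-rename dA r wΔ
    in transport (_ ⊩ _ ∶_) (sym (rename-[] ρ B u))
         (appl rl dA' (⊩-rename dB (Ren-ext r) (wΔ ∷ dA')) (⊩-rename dt r wΔ) (⊩-rename du r wΔ))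
  ⊩-rename {ρ = ρ} (conv d dB c) r wΔ = conv (⊩-rename d r wΔ) (⊩-rename dB r wΔ) (≃-rename ρ c)

  ⊩-weaken : ∀ {Γ t T A s} → Γ ⊩ t ∶ T → Γ ⊩ A ∶ sort s → (A ∷ Γ) ⊩ shift t ∶ shift T
  ⊩-weaken d dA = ⊩-rename d there (⊩-wf dA ∷ dA)

  Sub : Context → (ℕ → Term) → Context → Set
  Sub Δ σ Γ = ∀ {n T} → Γ ∋ n ∶ T → Δ ⊩ σ n ∶ subst σ T

  Sub-exts : ∀ {Γ Δ σ A s} → Sub Δ σ Γ → Δ ⊩ subst σ A ∶ sort s →
             Sub (subst σ A ∷ Δ) (exts σ) (A ∷ Γ)
  Sub-exts {Δ = Δ} {σ} {A} h dA here =
    transport (subst σ A ∷ Δ ⊩ var zero ∶_) (sym (subst-exts-shift σ A)) (var (⊩-wf dA ∷ dA) here)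
  Sub-exts {σ = σ} h dA (there {T = T} x) =
    transport (_ ⊩ _ ∶_) (sym (subst-exts-shift σ T)) (⊩-weaken (h x) dA)

  ⊩-subst : ∀ {Γ Δ σ t T} → Γ ⊩ t ∶ T → Sub Δ σ Γ → WF Δ → Δ ⊩ subst σ t ∶ subst σ T
  ⊩-subst (var w x) h wΔ     = h x
  ⊩-subst (axiom w a) h wΔ   = axiom wΔ a
  ⊩-subst (prod rl dA dB) h wΔ =
    let dA' = ⊩-subst dA h wΔ in prod rl dA' (⊩-subst dB (Sub-exts h dA') (wΔ ∷ dA'))
  ⊩-subst (abs rl dA dB dt) h wΔ =
    let dA' = ⊩-subst dA h wΔ
    in abs rl dA' (⊩-subst dB (Sub-exts h dA') (wΔ ∷ dA')) (⊩-subst dt (Sub-exts h dA') (wΔ ∷ dA'))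
  ⊩-subst {σ = σ} (appl {B = B} {u = u} rl dA dB dt du) h wΔ =
    let dA' = ⊩-subst dA h wΔ
    in transport (_ ⊩ _ ∶_) (sym (subst-[] σ B u))
         (appl rl dA' (⊩-subst dB (Sub-exts h dA') (wΔ ∷ dA')) (⊩-subst dt h wΔ) (⊩-subst du h wΔ))
  ⊩-subst {σ = σ} (conv d dB c) h wΔ = conv (⊩-subst d h wΔ) (⊩-subst dB h wΔ) (≃-subst σ c)

  Sub-single : ∀ {Γ u A} → Γ ⊩ u ∶ A → Sub Γ (single u) (A ∷ Γ)
  Sub-single {u = u} {A} du here = transport (_ ⊩ u ∶_) (sym (shift-[] A u)) du
  Sub-single {u = u} du (there {T = T} x) =
    transport (_ ⊩ _ ∶_) (sym (shift-[] T u)) (var (⊩-wf du) x)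

  ⊩-[] : ∀ {Γ A b B u} → (A ∷ Γ) ⊩ b ∶ B → Γ ⊩ u ∶ A → Γ ⊩ b [ u ] ∶ B [ u ]
  ⊩-[] d du = ⊩-subst d (Sub-single du) (⊩-wf du)

  infix 4 _⊑_
  _⊑_ : Context → Context → Set
  Γ ⊑ Δ = ∀ {t T} → Γ ⊩ t ∶ T → Δ ⊩ t ∶ T

  ⊑-refl : ∀ {Γ} → Γ ⊑ Γ
  ⊑-refl d = d

  Sub-var⇒⊑ : ∀ {Γ Δ} → Sub Δ var Γ → WF Δ → Γ ⊑ Δ
  Sub-var⇒⊑ h w {t} {T} d = transport₂ (_ ⊩_∶_) (subst-id t) (subst-id T) (⊩-subst d h w)

  ⊑-∷ : ∀ {Γ Δ A s} → Γ ⊑ Δ → Γ ⊩ A ∶ sort s → (A ∷ Γ) ⊑ (A ∷ Δ)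
  ⊑-∷ {A = A} Γ⊑Δ dA = Sub-var⇒⊑ h (⊩-wf dA' ∷ dA')
    where
    dA' = Γ⊑Δ dA
    h : Sub (A ∷ _) var (A ∷ _)
    h here = transport (_ ⊩ var zero ∶_) (sym (subst-id (shift A))) (var (⊩-wf dA' ∷ dA') here)
    h (there {T = T} x) =
      transport (_ ⊩ _ ∶_) (sym (subst-id (shift T))) (⊩-weaken (Γ⊑Δ (var (⊩-wf dA) x)) dA')

  ⊑-conv-head : ∀ {Γ A A' s s'} → Γ ⊩ A ∶ sort s → Γ ⊩ A' ∶ sort s' → A ≃ A' → (A ∷ Γ) ⊑ (A' ∷ Γ)
  ⊑-conv-head {A = A} {A'} dA dA' c = Sub-var⇒⊑ h w
    where
    w = ⊩-wf dA' ∷ dA'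
    h : Sub (A' ∷ _) var (A ∷ _)
    h here = transport (_ ⊩ var zero ∶_) (sym (subst-id (shift A)))
               (conv (var w here) (⊩-weaken dA dA') (≃-rename suc (≃-sym c)))
    h (there {T = T} x) = transport (_ ⊩ _ ∶_) (sym (subst-id (shift T))) (var w (there x))

  record PiInversion (Γ : Context) (A B T : Term) : Set where
    constructor piInv
    field
      {s₁ s₂ s₃} : S
      rule       : Rl s₁ s₂ s₃
      ⊩A         : Γ ⊩ A ∶ sort s₁
      ⊩B         : (A ∷ Γ) ⊩ B ∶ sort s₂
      ≃T         : sort s₃ ≃ T

  inv-pi : ∀ {Γ A B T} → Γ ⊩ pi A B ∶ T → PiInversion Γ A B T
  inv-pi (prod rl dA dB) = piInv rl dA dB Star.ε
  inv-pi (conv d _ c) with inv-pi d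
  ... | piInv rl dA dB c' = piInv rl dA dB (≃-trans c' c)

  record LamInversion (Γ : Context) (A t T : Term) : Set where
    constructor lamInv
    field
      {B}        : Term
      {s₁ s₂ s₃} : S
      rule       : Rl s₁ s₂ s₃
      ⊩A         : Γ ⊩ A ∶ sort s₁
      ⊩B         : (A ∷ Γ) ⊩ B ∶ sort s₂
      ⊩t         : (A ∷ Γ) ⊩ t ∶ B
      ≃T         : pi A B ≃ T

  inv-lam : ∀ {Γ A t T} → Γ ⊩ lam A t ∶ T → LamInversion Γ A t T
  inv-lam (abs rl dA dB dt) = lamInv rl dA dB dt Star.ε
  inv-lam (conv d _ c) with inv-lam d
  ... | lamInv rl dA dB dt c' = lamInv rl dA dB dt (≃-trans c' c)

  record AppInversion (Γ : Context) (t u T : Term) : Set where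
    constructor appInv
    field
      {A B}      : Term
      {s₁ s₂ s₃} : S
      rule       : Rl s₁ s₂ s₃
      ⊩A         : Γ ⊩ A ∶ sort s₁
      ⊩B         : (A ∷ Γ) ⊩ B ∶ sort s₂
      ⊩t         : Γ ⊩ t ∶ pi A B
      ⊩u         : Γ ⊩ u ∶ A
      ≃T         : (B [ u ]) ≃ T

  inv-app : ∀ {Γ t u T} → Γ ⊩ app t u ∶ T → AppInversion Γ t u T
  inv-app (appl rl dA dB dt du) = appInv rl dA dB dt du Star.ε
  inv-app (conv d _ c) with inv-app d
  ... | appInv rl dA dB dt du c' = appInv rl dA dB dt du (≃-trans c' c)

  inv-sort : ∀ {Γ s T} → Γ ⊩ sort s ∶ T → ∃ λ s₂ → Ax s s₂ × sort s₂ ≃ T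
  inv-sort (axiom w a) = _ , a , Star.ε
  inv-sort (conv d _ c) with inv-sort d
  ... | s₂ , a , c' = s₂ , a , ≃-trans c' c

  inv-var : ∀ {Γ n T} → Γ ⊩ var n ∶ T → ∃ λ T₀ → Γ ∋ n ∶ T₀ × T₀ ≃ T
  inv-var (var w x) = _ , x , Star.ε
  inv-var (conv d _ c) with inv-var d
  ... | T₀ , x , c' = T₀ , x , ≃-trans c' c

  ∋-typed : ∀ {Γ n T} → WF Γ → Γ ∋ n ∶ T → ∃ λ s → Γ ⊩ T ∶ sort s
  ∋-typed (w ∷ dA) here = _ , ⊩-weaken dA dA
  ∋-typed (w ∷ dB) (there x) with ∋-typed w x
  ... | s , dT = s , ⊩-weaken dT dB

  type-correct : ∀ {Γ t T} → Γ ⊩ t ∶ T → (∃ λ s → Γ ⊩ T ∶ sort s) ⊎ (∃ λ s → T ≡ sort s)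
  type-correct (var w x)             = inj₁ (∋-typed w x)
  type-correct (axiom w a)           = inj₂ (_ , refl)
  type-correct (prod rl dA dB)       = inj₂ (_ , refl)
  type-correct (abs rl dA dB dt)     = inj₁ (_ , prod rl dA dB)
  type-correct (appl rl dA dB dt du) = inj₁ (_ , ⊩-[] dB du)
  type-correct (conv d dB c)         = inj₁ (_ , dB)

  subject-reduction : ∀ {Γ t t₁ T} → Γ ⊩ t ∶ T → t ⟶ t₁ → Γ ⊩ t₁ ∶ T
  subject-reduction (var w x) (rw ())
  subject-reduction (axiom w a) (rw ())
  subject-reduction (prod rl dA dB) (rw ())
  subject-reduction (prod rl dA dB) (piˡ s) =
    let dA₁ = subject-reduction dA s
    in prod rl dA₁ (⊑-conv-head dA dA₁ (EqClosure.return s) dB)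
  subject-reduction (prod rl dA dB) (piʳ s) = prod rl dA (subject-reduction dB s)
  subject-reduction (abs rl dA dB dt) (rw ())
  subject-reduction (abs rl dA dB dt) (lamˡ s) =
    let dA₁ = subject-reduction dA s
        A⊑A₁ = ⊑-conv-head dA dA₁ (EqClosure.return s)
    in conv (abs rl dA₁ (A⊑A₁ dB) (A⊑A₁ dt)) (prod rl dA dB) (≃-sym (EqClosure.return (piˡ s)))
  subject-reduction (abs rl dA dB dt) (lamʳ s) = abs rl dA dB (subject-reduction dt s)
  subject-reduction (appl rl dA dB dt du) (rw ())
  subject-reduction (appl rl dA dB dt du) (appˡ s) = appl rl dA dB (subject-reduction dt s) du
  subject-reduction (appl {B = B} rl dA dB dt du) (appʳ s) =
    conv (appl rl dA dB dt (subject-reduction du s)) (⊩-[] dB du) (≃-sym (⟶*⇒≃ ([]-⟶* B s)))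
  subject-reduction (appl {u = u} rl dA dB dt du) beta with inv-lam dt
  ... | lamInv _ dA₀ _ db c with pi-injective c
  ... | A≃A₀ , B₀≃B =
    conv (⊩-[] db (conv du dA₀ (≃-sym A≃A₀))) (⊩-[] dB du) (≃-subst (single u) B₀≃B)
  subject-reduction (conv d dB c) s = conv (subject-reduction d s) dB c

  subject-reduction* : ∀ {Γ t t₁ T} → Γ ⊩ t ∶ T → t ⟶* t₁ → Γ ⊩ t₁ ∶ T
  subject-reduction* d Star.ε  = d
  subject-reduction* d (s ◅ r) = subject-reduction* (subject-reduction d s) r

  ⊑-reduce-head : ∀ {Γ A A₁ s} → Γ ⊩ A ∶ sort s → A ⟶ A₁ → (A ∷ Γ) ⊑ (A₁ ∷ Γ)
  ⊑-reduce-head dA s = ⊑-conv-head dA (subject-reduction dA s) (EqClosure.return s)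

  ⊢⇒⊩ : ∀ {Γ t T} → Γ ⊢ t ∶ T → Γ ⊩ t ∶ T
  ⊢⇒⊩ (PTy.axiom a)           = axiom [] a
  ⊢⇒⊩ (PTy.const {c = ()} _ _)
  ⊢⇒⊩ (PTy.start dA)          = let dA' = ⊢⇒⊩ dA in var (⊩-wf dA' ∷ dA') here
  ⊢⇒⊩ (PTy.weak d dA)         = ⊩-weaken (⊢⇒⊩ d) (⊢⇒⊩ dA)
  ⊢⇒⊩ (PTy.prod rl dA dB)     = prod rl (⊢⇒⊩ dA) (⊢⇒⊩ dB)
  ⊢⇒⊩ (PTy.abs dt dpi) with inv-pi (⊢⇒⊩ dpi)
  ... | piInv rl dA dB _ = abs rl dA dB (⊢⇒⊩ dt)
  ⊢⇒⊩ (PTy.appl dt du) with type-correct (⊢⇒⊩ dt)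
  ... | inj₂ (_ , ())
  ... | inj₁ (_ , dpi) with inv-pi dpi
  ... | piInv rl dA dB _ = appl rl dA dB (⊢⇒⊩ dt) (⊢⇒⊩ du)
  ⊢⇒⊩ (PTy.conv d dB c)       = conv (⊢⇒⊩ d) (⊢⇒⊩ dB) c

  ⊩⇒⊢ : ∀ {Γ t T} → Γ ⊩ t ∶ T → Γ ⊢ t ∶ T
  ⊩⇒⊢ (var w x)             = var⇒⊢ w x
    where
    var⇒⊢ : ∀ {Γ n T} → WF Γ → Γ ∋ n ∶ T → Γ ⊢ var n ∶ T
    var⇒⊢ (w ∷ dA) here      = PTy.start (⊩⇒⊢ dA)
    var⇒⊢ (w ∷ dB) (there x) = PTy.weak (var⇒⊢ w x) (⊩⇒⊢ dB)
  ⊩⇒⊢ (axiom {s₁ = s₁} {s₂} w a) = axiom⇒⊢ w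
    where
    axiom⇒⊢ : ∀ {Γ} → WF Γ → Γ ⊢ sort s₁ ∶ sort s₂
    axiom⇒⊢ []       = PTy.axiom a
    axiom⇒⊢ (w ∷ dB) = PTy.weak (axiom⇒⊢ w) (⊩⇒⊢ dB)
  ⊩⇒⊢ (prod rl dA dB)       = PTy.prod rl (⊩⇒⊢ dA) (⊩⇒⊢ dB)
  ⊩⇒⊢ (abs rl dA dB dt)     = PTy.abs (⊩⇒⊢ dt) (PTy.prod rl (⊩⇒⊢ dA) (⊩⇒⊢ dB))
  ⊩⇒⊢ (appl rl dA dB dt du) = PTy.appl (⊩⇒⊢ dt) (⊩⇒⊢ du)
  ⊩⇒⊢ (conv d dB c)         = PTy.conv (⊩⇒⊢ d) (⊩⇒⊢ dB) c

-- The translation, on the source side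

module Translation (S : Set) (Ax : S → S → Set) (Rl : S → S → S → Set)
                   (functional : PTS.Functional S Ax Rl) where
  open PTS S Ax Rl
  open Metatheory S Ax Rl
  open P using (Term; Context; var; sort; const; pi; lam; app; rename; subst; exts; single; _[_])
  open PRed using (_⟶_; _≃_; beta; rw; piˡ; piʳ; lamˡ; lamʳ; appˡ; appʳ)

  type-unique : ∀ {Γ T₁ T₂} t → Γ ⊩ t ∶ T₁ → Γ ⊩ t ∶ T₂ → T₁ ≃ T₂
  type-unique (var n) d₁ d₂ with inv-var d₁ | inv-var d₂
  ... | _ , x₁ , c₁ | _ , x₂ , c₂ with ∋-functional x₁ x₂
  ... | refl = ≃-trans (≃-sym c₁) c₂
  type-unique (sort s) d₁ d₂ with inv-sort d₁ | inv-sort d₂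
  ... | _ , a₁ , c₁ | _ , a₂ , c₂ with proj₁ functional a₁ a₂
  ... | refl = ≃-trans (≃-sym c₁) c₂
  type-unique (const ()) d₁ d₂
  type-unique (pi A B) d₁ d₂ with inv-pi d₁ | inv-pi d₂
  ... | piInv rl₁ dA₁ dB₁ c₁ | piInv rl₂ dA₂ dB₂ c₂ with sort-injective (type-unique A dA₁ dA₂)
  ... | refl with sort-injective (type-unique B dB₁ dB₂)
  ... | refl with proj₂ functional rl₁ rl₂
  ... | refl = ≃-trans (≃-sym c₁) c₂
  type-unique (lam A t) d₁ d₂ with inv-lam d₁ | inv-lam d₂
  ... | lamInv _ _ _ dt₁ c₁ | lamInv _ _ _ dt₂ c₂ =
    ≃-trans (≃-sym c₁) (≃-trans (EqClosure.gmap _ piʳ (type-unique t dt₁ dt₂)) c₂)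
  type-unique (app t u) d₁ d₂ with inv-app d₁ | inv-app d₂
  ... | appInv _ _ _ dt₁ _ c₁ | appInv _ _ _ dt₂ _ c₂ =
    ≃-trans (≃-sym c₁)
            (≃-trans (≃-subst (single u) (proj₂ (pi-injective (type-unique t dt₁ dt₂)))) c₂)

  sort-unique : ∀ {Γ t s s'} → Γ ⊩ t ∶ sort s → Γ ⊩ t ∶ sort s' → s ≡ s'
  sort-unique d₁ d₂ = sort-injective (type-unique _ d₁ d₂)

  El : S → L.Term → L.Term
  El s X = L.app (L.const (ε s)) X

  Π̇ : S → S → S → L.Term → L.Term → L.Term
  Π̇ s₁ s₂ s₃ A B = L.app (L.app (L.const (dotΠ s₁ s₂ s₃)) A) (L.lam (El s₁ A) B)

  Tr-pi : ∀ {Γ A B A' B' s₁ s₂ s₃} → Rl s₁ s₂ s₃ → Γ ⊩ A ∶ sort s₁ → (A ∷ Γ) ⊩ B ∶ sort s₂ →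
          Tr Γ A A' → Tr (A ∷ Γ) B B' → Tr Γ (pi A B) (Π̇ s₁ s₂ s₃ A' B')
  Tr-pi rl dA dB = pi (⊩⇒⊢ dA) (⊩⇒⊢ dB) (⊩⇒⊢ (prod rl dA dB))

  Tr-exists : ∀ {Γ t T} → Γ ⊩ t ∶ T → ∃ (Tr Γ t)
  Tr-exists (var w x)             = _ , var
  Tr-exists (axiom w a)           = _ , sort
  Tr-exists (prod rl dA dB)       = _ , Tr-pi rl dA dB (proj₂ (Tr-exists dA)) (proj₂ (Tr-exists dB))
  Tr-exists (abs rl dA dB dt)     = _ , lam (⊩⇒⊢ dA) (proj₂ (Tr-exists dA)) (proj₂ (Tr-exists dt))
  Tr-exists (appl rl dA dB dt du) = _ , app (proj₂ (Tr-exists dt)) (proj₂ (Tr-exists du))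
  Tr-exists (conv d dB c)         = Tr-exists d

  Tr-rename : ∀ {Γ Δ ρ t t'} → Tr Γ t t' → Ren Δ ρ Γ → WF Δ → Tr Δ (rename ρ t) (L.rename ρ t')
  Tr-rename var r w = var
  Tr-rename sort r w = sort
  Tr-rename (pi dA dB dpi trA trB) r w =
    let dA' = ⊩-rename (⊢⇒⊩ dA) r w
        w' = w ∷ dA'
    in pi (⊩⇒⊢ dA') (⊩⇒⊢ (⊩-rename (⊢⇒⊩ dB) (Ren-ext r) w')) (⊩⇒⊢ (⊩-rename (⊢⇒⊩ dpi) r w))
          (Tr-rename trA r w) (Tr-rename trB (Ren-ext r) w')
  Tr-rename (lam dA trA trt) r w =
    let dA' = ⊩-rename (⊢⇒⊩ dA) r w
    in lam (⊩⇒⊢ dA') (Tr-rename trA r w) (Tr-rename trt (Ren-ext r) (w ∷ dA'))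
  Tr-rename (app trt tru) r w = app (Tr-rename trt r w) (Tr-rename tru r w)

  Tr-exts : ∀ {Δ σ σ' A s} → WF Δ → Δ ⊩ A ∶ sort s → (∀ n → Tr Δ (σ n) (σ' n)) →
            ∀ n → Tr (A ∷ Δ) (exts σ n) (L.exts σ' n)
  Tr-exts w dA trσ zero    = var
  Tr-exts w dA trσ (suc n) = Tr-rename (trσ n) there (w ∷ dA)

  Tr-subst : ∀ {Γ Δ σ σ' t t'} → Tr Γ t t' → Sub Δ σ Γ → WF Δ → (∀ n → Tr Δ (σ n) (σ' n)) →
             Tr Δ (subst σ t) (L.subst σ' t')
  Tr-subst var h w trσ = trσ _
  Tr-subst sort h w trσ = sort
  Tr-subst (pi dA dB dpi trA trB) h w trσ =
    let dA' = ⊩-subst (⊢⇒⊩ dA) h w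
        w' = w ∷ dA'
    in pi (⊩⇒⊢ dA') (⊩⇒⊢ (⊩-subst (⊢⇒⊩ dB) (Sub-exts h dA') w')) (⊩⇒⊢ (⊩-subst (⊢⇒⊩ dpi) h w))
          (Tr-subst trA h w trσ) (Tr-subst trB (Sub-exts h dA') w' (Tr-exts w dA' trσ))
  Tr-subst (lam dA trA trt) h w trσ =
    let dA' = ⊩-subst (⊢⇒⊩ dA) h w
    in lam (⊩⇒⊢ dA') (Tr-subst trA h w trσ)
           (Tr-subst trt (Sub-exts h dA') (w ∷ dA') (Tr-exts w dA' trσ))
  Tr-subst (app trt tru) h w trσ = app (Tr-subst trt h w trσ) (Tr-subst tru h w trσ)

  Tr-[] : ∀ {Γ A b b' u u'} → Tr (A ∷ Γ) b b' → Γ ⊩ u ∶ A → Tr Γ u u' → Tr Γ (b [ u ]) (b' L.[ u' ])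
  Tr-[] {Γ} {u = u} {u'} trb du tru = Tr-subst trb (Sub-single du) (⊩-wf du) Tr-single
    where
    Tr-single : ∀ n → Tr Γ (single u n) (L.single u' n)
    Tr-single zero    = tru
    Tr-single (suc n) = var

  Tr-unique : ∀ {Γ Δ t t₁ t₂} → Γ ⊑ Δ → Tr Γ t t₁ → Tr Δ t t₂ → t₁ ≡ t₂
  Tr-unique Γ⊑Δ var var = refl
  Tr-unique Γ⊑Δ sort sort = refl
  Tr-unique Γ⊑Δ (pi dA dB dpi trA trB) (pi dA₂ dB₂ dpi₂ trA₂ trB₂)
    with sort-unique (Γ⊑Δ (⊢⇒⊩ dA)) (⊢⇒⊩ dA₂)
       | sort-unique (⊑-∷ Γ⊑Δ (⊢⇒⊩ dA) (⊢⇒⊩ dB)) (⊢⇒⊩ dB₂)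
       | sort-unique (Γ⊑Δ (⊢⇒⊩ dpi)) (⊢⇒⊩ dpi₂)
  ... | refl | refl | refl =
    cong₂ (Π̇ _ _ _) (Tr-unique Γ⊑Δ trA trA₂) (Tr-unique (⊑-∷ Γ⊑Δ (⊢⇒⊩ dA)) trB trB₂)
  Tr-unique Γ⊑Δ (lam dA trA trt) (lam dA₂ trA₂ trt₂) with sort-unique (Γ⊑Δ (⊢⇒⊩ dA)) (⊢⇒⊩ dA₂)
  ... | refl = cong₂ (L.lam ∘ El _) (Tr-unique Γ⊑Δ trA trA₂) (Tr-unique (⊑-∷ Γ⊑Δ (⊢⇒⊩ dA)) trt trt₂)
  Tr-unique Γ⊑Δ (app trt tru) (app trt₂ tru₂) =
    cong₂ L.app (Tr-unique Γ⊑Δ trt trt₂) (Tr-unique Γ⊑Δ tru tru₂)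

  infix 4 _≃ᴸ_
  _≃ᴸ_ : L.Term → L.Term → Set
  _≃ᴸ_ = LRed._≃_

  El-cong : ∀ {s X X'} → X ≃ᴸ X' → El s X ≃ᴸ El s X'
  El-cong = EqClosure.gmap _ LRed.appʳ

  Π̇-congˡ : ∀ {s₁ s₂ s₃ A A' B} → A ≃ᴸ A' → Π̇ s₁ s₂ s₃ A B ≃ᴸ Π̇ s₁ s₂ s₃ A' B
  Π̇-congˡ c = EqClosure.gmap _ (λ r → LRed.appˡ (LRed.appʳ r)) c
           ◅◅ EqClosure.gmap _ (λ r → LRed.appʳ (LRed.lamˡ (LRed.appʳ r))) c

  Π̇-congʳ : ∀ {s₁ s₂ s₃ A B B'} → B ≃ᴸ B' → Π̇ s₁ s₂ s₃ A B ≃ᴸ Π̇ s₁ s₂ s₃ A B'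
  Π̇-congʳ = EqClosure.gmap _ (λ r → LRed.appʳ (LRed.lamʳ r))

  Tr-step : ∀ {Γ a a₁ T a' a₁'} → Γ ⊩ a ∶ T → a ⟶ a₁ → Tr Γ a a' → Tr Γ a₁ a₁' → a' ≃ᴸ a₁'
  Tr-step d (rw ()) _ _
  Tr-step d beta (app (lam _ _ trb) tru) tr₁ with inv-app d
  ... | appInv _ _ _ dt du _ with inv-lam dt
  ... | lamInv _ dA _ _ c
      with Tr-unique ⊑-refl (Tr-[] trb (conv du dA (≃-sym (proj₁ (pi-injective c)))) tru) tr₁
  ... | refl = EqClosure.return LRed.beta
  Tr-step d (piˡ s) (pi dA dB dpi trA trB) (pi dA₁ dB₁ dpi₁ trA₁ trB₁)
    with sort-unique (subject-reduction (⊢⇒⊩ dA) s) (⊢⇒⊩ dA₁)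
       | sort-unique (⊑-reduce-head (⊢⇒⊩ dA) s (⊢⇒⊩ dB)) (⊢⇒⊩ dB₁)
       | sort-unique (subject-reduction (⊢⇒⊩ dpi) (piˡ s)) (⊢⇒⊩ dpi₁)
       | Tr-unique (⊑-reduce-head (⊢⇒⊩ dA) s) trB trB₁
  ... | refl | refl | refl | refl = Π̇-congˡ (Tr-step (⊢⇒⊩ dA) s trA trA₁)
  Tr-step d (piʳ s) (pi dA dB dpi trA trB) (pi dA₁ dB₁ dpi₁ trA₁ trB₁)
    with sort-unique (⊢⇒⊩ dA) (⊢⇒⊩ dA₁)
       | sort-unique (subject-reduction (⊢⇒⊩ dB) s) (⊢⇒⊩ dB₁)
       | sort-unique (subject-reduction (⊢⇒⊩ dpi) (piʳ s)) (⊢⇒⊩ dpi₁)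
       | Tr-unique ⊑-refl trA trA₁
  ... | refl | refl | refl | refl = Π̇-congʳ (Tr-step (⊢⇒⊩ dB) s trB trB₁)
  Tr-step d (lamˡ s) (lam dA trA trt) (lam dA₁ trA₁ trt₁)
    with sort-unique (subject-reduction (⊢⇒⊩ dA) s) (⊢⇒⊩ dA₁)
       | Tr-unique (⊑-reduce-head (⊢⇒⊩ dA) s) trt trt₁
  ... | refl | refl =
    EqClosure.gmap _ (λ r → LRed.lamˡ (LRed.appʳ r)) (Tr-step (⊢⇒⊩ dA) s trA trA₁)
  Tr-step d (lamʳ s) (lam dA trA trt) (lam dA₁ trA₁ trt₁) with inv-lam d
  ... | lamInv _ _ _ dt _ with sort-unique (⊢⇒⊩ dA) (⊢⇒⊩ dA₁) | Tr-unique ⊑-refl trA trA₁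
  ... | refl | refl = EqClosure.gmap _ LRed.lamʳ (Tr-step dt s trt trt₁)
  Tr-step d (appˡ s) (app trt tru) (app trt₁ tru₁) with inv-app d | Tr-unique ⊑-refl tru tru₁
  ... | appInv _ _ _ dt _ _ | refl = EqClosure.gmap _ LRed.appˡ (Tr-step dt s trt trt₁)
  Tr-step d (appʳ s) (app trt tru) (app trt₁ tru₁) with inv-app d | Tr-unique ⊑-refl trt trt₁
  ... | appInv _ _ _ _ du _ | refl = EqClosure.gmap _ LRed.appʳ (Tr-step du s tru tru₁)

  Tr-steps : ∀ {Γ a c T a' c'} → Γ ⊩ a ∶ T → a ⟶* c → Tr Γ a a' → Tr Γ c c' → a' ≃ᴸ c'
  Tr-steps d Star.ε tr₁ tr₂ with Tr-unique ⊑-refl tr₁ tr₂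
  ... | refl = Star.ε
  Tr-steps d (s ◅ r) tr₁ tr₂ =
    let d₁ = subject-reduction d s
        tr = proj₂ (Tr-exists d₁)
    in Tr-step d s tr₁ tr ◅◅ Tr-steps d₁ r tr tr₂

  ≃ᴸ-sym : ∀ {a b} → a ≃ᴸ b → b ≃ᴸ a
  ≃ᴸ-sym = EqClosure.symmetric LRed._⟶_

  El-dot≃U : ∀ {s₁ s₂} → Ax s₁ s₂ → El s₂ (L.const (dot s₁)) ≃ᴸ L.const (U s₁)
  El-dot≃U a = EqClosure.return (LRed.rw (rwAx a))

  El-Π̇≃Π : ∀ {s₁ s₂ s₃ A B} → Rl s₁ s₂ s₃ → El s₃ (Π̇ s₁ s₂ s₃ A B) ≃ᴸ L.pi (El s₁ A) (El s₂ B)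
  El-Π̇≃Π {s₁} {s₂} {s₃} {A} {B} rl =
    transport (λ B₀ → El s₃ (Π̇ s₁ s₂ s₃ A B) ≃ᴸ L.pi (El s₁ A) (El s₂ B₀))
              (Substitution.rename-ext-suc-[var0] LSort Const B)
              (Sym.fwd (LRed.rw (rwRl rl A (L.lam (El s₁ A) B)))
                 ◅ EqClosure.return (LRed.piʳ (LRed.appʳ LRed.beta)))

  -- ‖T‖, except that U_s is admitted for every sort s, typable or not; by El-dot≃U the two
  -- candidates for a typable sort are convertible.
  data TypeTr (Γ : Context) (T : Term) : L.Term → Set where
    el   : ∀ {T' s} → Γ ⊩ T ∶ sort s → Tr Γ T T' → TypeTr Γ T (El s T')
    univ : ∀ {s} → T ≡ sort s → TypeTr Γ T (L.const (U s))

  TrType⇒TypeTr : ∀ {Γ T T'} → TrType Γ T T' → TypeTr Γ T T'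
  TrType⇒TypeTr (typed dT tr) = el (⊢⇒⊩ dT) tr
  TrType⇒TypeTr (top _)       = univ refl

  TypeTr-of-type : ∀ {Γ t T} → Γ ⊩ t ∶ T → ∃ (TypeTr Γ T)
  TypeTr-of-type d with type-correct d
  ... | inj₁ (_ , dT)   = _ , el dT (proj₂ (Tr-exists dT))
  ... | inj₂ (_ , refl) = _ , univ refl

  TypeTr-weaken : ∀ {Γ T T' A s} → Γ ⊩ A ∶ sort s → TypeTr Γ T T' →
                  TypeTr (A ∷ Γ) (P.shift T) (L.shift T')
  TypeTr-weaken dA (el dT tr) = el (⊩-weaken dT dA) (Tr-rename tr there (⊩-wf dA ∷ dA))
  TypeTr-weaken dA (univ refl) = univ refl

  TypeTr-conv : ∀ {Γ A B A' B'} → TypeTr Γ A A' → TypeTr Γ B B' → A ≃ B → A' ≃ᴸ B'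
  TypeTr-conv (el dA trA) (el dB trB) c with church-rosser c
  ... | C , A⟶*C , B⟶*C
      with sort-unique (subject-reduction* dA A⟶*C) (subject-reduction* dB B⟶*C)
  ... | refl with Tr-exists (subject-reduction* dA A⟶*C)
  ... | _ , trC = El-cong (Tr-steps dA A⟶*C trA trC) ◅◅ ≃ᴸ-sym (El-cong (Tr-steps dB B⟶*C trB trC))
  TypeTr-conv (el dA trA) (univ refl) c with church-rosser c
  ... | C , A⟶*C , s⟶*C with sort-⟶* s⟶*C
  ... | refl with inv-sort (subject-reduction* dA A⟶*C)
  ... | _ , a , c' with sort-injective c'
  ... | refl = El-cong (Tr-steps dA A⟶*C trA sort) ◅◅ El-dot≃U a
  TypeTr-conv (univ refl) (el dB trB) c = ≃ᴸ-sym (TypeTr-conv (el dB trB) (univ refl) (≃-sym c))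
  TypeTr-conv (univ refl) (univ refl) c with sort-injective c
  ... | refl = Star.ε

-- Typing in λΠ_P and soundness of the translation

module Soundness (S : Set) (Ax : S → S → Set) (Rl : S → S → S → Set)
                 (functional : PTS.Functional S Ax Rl) where
  open PTS S Ax Rl
  open Metatheory S Ax Rl
  open Translation S Ax Rl functional
  open P using (sort)

  -- Constants of Σ_P are typed in the empty context only; this property of Γ' takes the
  -- place of its well-formedness.
  LiftsClosed : L.Context → Set
  LiftsClosed Γ' = ∀ {c C} → L.shift c ≡ c → L.shift C ≡ C → [] ⊢λΠ c ∶ C → Γ' ⊢λΠ c ∶ C

  LiftsClosed-∷ : ∀ {Γ' A k} → LiftsClosed Γ' → Γ' ⊢λΠ A ∶ L.sort k → LiftsClosed (A ∷ Γ')
  LiftsClosed-∷ lift ⊢A c≡ C≡ d = transport₂ (_ ⊢λΠ_∶_) c≡ C≡ (LTy.weak (lift c≡ C≡ d) ⊢A)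

  ⊢U : ∀ {s} → [] ⊢λΠ L.const (U s) ∶ L.sort type
  ⊢U = LTy.const declU (LTy.axiom type:kind)

  ⊢ε : ∀ {s} → [] ⊢λΠ L.const (ε s) ∶ L.pi (L.const (U s)) (L.sort type)
  ⊢ε = LTy.const declε (LTy.prod tkk ⊢U (LTy.weak (LTy.axiom type:kind) ⊢U))

  ⊢dot : ∀ {s₁ s₂} → Ax s₁ s₂ → [] ⊢λΠ L.const (dot s₁) ∶ L.const (U s₂)
  ⊢dot a = LTy.const (decldot a) ⊢U

  ⊢dotΠ : ∀ {s₁ s₂ s₃} → Rl s₁ s₂ s₃ →
          [] ⊢λΠ L.const (dotΠ s₁ s₂ s₃)
             ∶ L.pi (L.const (U s₁)) (L.pi (L.pi (El s₁ (L.var 0)) (L.const (U s₂))) (L.const (U s₃)))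
  ⊢dotΠ {s₁} {s₂} rl =
    LTy.const (declΠ rl) (LTy.prod ttt ⊢U (LTy.prod ttt ⊢Fam (LTy.weak (LTy.weak ⊢U ⊢U) ⊢Fam)))
    where
    ⊢El-X : (L.const (U s₁) ∷ []) ⊢λΠ El s₁ (L.var 0) ∶ L.sort type
    ⊢El-X = LTy.appl (LTy.weak ⊢ε ⊢U) (LTy.start ⊢U)
    ⊢Fam : (L.const (U s₁) ∷ []) ⊢λΠ L.pi (El s₁ (L.var 0)) (L.const (U s₂)) ∶ L.sort type
    ⊢Fam = LTy.prod ttt ⊢El-X (LTy.weak (LTy.weak ⊢U ⊢U) ⊢El-X)

  ⊢El : ∀ {Γ' X s} → LiftsClosed Γ' → Γ' ⊢λΠ X ∶ L.const (U s) → Γ' ⊢λΠ El s X ∶ L.sort type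
  ⊢El lift ⊢X = LTy.appl (lift refl refl ⊢ε) ⊢X

  ⊢Π̇ : ∀ {Γ' A B s₁ s₂ s₃} → LiftsClosed Γ' → Rl s₁ s₂ s₃ → Γ' ⊢λΠ A ∶ L.const (U s₁) →
       (El s₁ A ∷ Γ') ⊢λΠ B ∶ L.const (U s₂) → Γ' ⊢λΠ Π̇ s₁ s₂ s₃ A B ∶ L.const (U s₃)
  ⊢Π̇ lift rl ⊢A ⊢B =
    let ⊢ElA = ⊢El lift ⊢A
    in LTy.appl (LTy.appl (lift refl refl (⊢dotΠ rl)) ⊢A)
                (LTy.abs ⊢B (LTy.prod ttt ⊢ElA (LiftsClosed-∷ lift ⊢ElA refl refl ⊢U)))

  ⊢Π-El : ∀ {Γ' A B s₁ s₂} → LiftsClosed Γ' → Γ' ⊢λΠ A ∶ L.const (U s₁) →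
          (El s₁ A ∷ Γ') ⊢λΠ B ∶ L.const (U s₂) → Γ' ⊢λΠ L.pi (El s₁ A) (El s₂ B) ∶ L.sort type
  ⊢Π-El lift ⊢A ⊢B = let ⊢ElA = ⊢El lift ⊢A in LTy.prod ttt ⊢ElA (⊢El (LiftsClosed-∷ lift ⊢ElA) ⊢B)

  retype : ∀ {Γ Γ' T x T₁ T₂} → LiftsClosed Γ' → Γ' ⊢λΠ x ∶ T₁ →
           TypeTr Γ T T₁ → TypeTr Γ T T₂ → Γ' ⊢λΠ x ∶ T₂
  retype lift d (el d₁ tr₁) (el d₂ tr₂) with sort-unique d₁ d₂ | Tr-unique ⊑-refl tr₁ tr₂
  ... | refl | refl = d
  retype lift d (el d₁ sort) (univ refl) with inv-sort d₁
  ... | _ , a , c with sort-injective c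
  ... | refl = LTy.conv d (lift refl refl ⊢U) (El-dot≃U a)
  retype lift d (univ refl) (el d₂ sort) with inv-sort d₂
  ... | _ , a , c with sort-injective c
  ... | refl = LTy.conv d (⊢El lift (lift refl refl (⊢dot a))) (≃ᴸ-sym (El-dot≃U a))
  retype lift d (univ refl) (univ refl) = d

  soundness : ∀ {Γ Γ' t T t' T'} → Γ ⊩ t ∶ T → TrCtx Γ Γ' → LiftsClosed Γ' →
              Tr Γ t t' → TypeTr Γ T T' → Γ' ⊢λΠ t' ∶ T'
  soundness-var : ∀ {Γ Γ' n T T'} → WF Γ → TrCtx Γ Γ' → Γ ∋ n ∶ T → TypeTr Γ T T' →
                  Γ' ⊢λΠ L.var n ∶ T'
  soundness-Π : ∀ {Γ Γ' A B A' B' s₁ s₂ s₃} → Rl s₁ s₂ s₃ →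
                Γ ⊩ A ∶ sort s₁ → (A ∷ Γ) ⊩ B ∶ sort s₂ → TrCtx Γ Γ' → LiftsClosed Γ' →
                Tr Γ A A' → Tr (A ∷ Γ) B B' →
                Γ' ⊢λΠ Π̇ s₁ s₂ s₃ A' B' ∶ L.const (U s₃) ×
                Γ' ⊢λΠ L.pi (El s₁ A') (El s₂ B') ∶ L.sort type
  TypeTr-typed : ∀ {Γ Γ' T T' s} → Γ ⊩ T ∶ sort s → TrCtx Γ Γ' → LiftsClosed Γ' →
                 TypeTr Γ T T' → Γ' ⊢λΠ T' ∶ L.sort type
  TrType-typed : ∀ {Γ Γ' A A' s} → WF Γ → Γ ⊩ A ∶ sort s → TrCtx Γ Γ' → TrType Γ A A' →
                 Γ' ⊢λΠ A' ∶ L.sort type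
  TrCtx-lifts : ∀ {Γ Γ'} → WF Γ → TrCtx Γ Γ' → LiftsClosed Γ'

  soundness (var w x) tΓ lift var tT = soundness-var w tΓ x tT
  soundness (axiom w a) tΓ lift sort tT = retype lift (lift refl refl (⊢dot a)) (univ refl) tT
  soundness (prod rl dA dB) tΓ lift (pi dA₂ dB₂ dpi₂ trA trB) tT
    with sort-unique dA (⊢⇒⊩ dA₂) | sort-unique dB (⊢⇒⊩ dB₂)
       | sort-unique (prod rl dA dB) (⊢⇒⊩ dpi₂)
  ... | refl | refl | refl =
    retype lift (proj₁ (soundness-Π rl dA dB tΓ lift trA trB)) (univ refl) tT
  soundness (abs rl dA dB dt) tΓ lift (lam dA₂ trA trt) tT
    with sort-unique dA (⊢⇒⊩ dA₂) | Tr-exists dB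
  ... | refl | _ , trB =
    let ⊢A' = soundness dA tΓ lift trA (univ refl)
        ⊢t' = soundness dt (typed dA₂ trA ∷ tΓ) (LiftsClosed-∷ lift (⊢El lift ⊢A')) trt (el dB trB)
        ⊢Π̇AB , ⊢ΠAB = soundness-Π rl dA dB tΓ lift trA trB
    in retype lift (LTy.conv (LTy.abs ⊢t' ⊢ΠAB) (⊢El lift ⊢Π̇AB) (≃ᴸ-sym (El-Π̇≃Π rl)))
              (el (prod rl dA dB) (Tr-pi rl dA dB trA trB)) tT
  soundness (appl rl dA dB dt du) tΓ lift (app trt tru) tT with Tr-exists dA | Tr-exists dB
  ... | _ , trA | _ , trB =
    let ⊢t' = soundness dt tΓ lift trt (el (prod rl dA dB) (Tr-pi rl dA dB trA trB))
        ⊢u' = soundness du tΓ lift tru (el dA trA)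
        ⊢ΠAB = proj₂ (soundness-Π rl dA dB tΓ lift trA trB)
    in retype lift (LTy.appl (LTy.conv ⊢t' ⊢ΠAB (El-Π̇≃Π rl)) ⊢u')
              (el (⊩-[] dB du) (Tr-[] trB du tru)) tT
  soundness (conv d dB c) tΓ lift tr tT with TypeTr-of-type d
  ... | _ , tA =
    LTy.conv (soundness d tΓ lift tr tA) (TypeTr-typed dB tΓ lift tT) (TypeTr-conv tA tT c)

  soundness-var (w ∷ dA) (tA ∷ tΓ) here tT =
    let ⊢A' = TrType-typed w dA tΓ tA
    in retype (LiftsClosed-∷ (TrCtx-lifts w tΓ) ⊢A') (LTy.start ⊢A')
              (TypeTr-weaken dA (TrType⇒TypeTr tA)) tT
  soundness-var (w ∷ dB) (tB ∷ tΓ) (there x) tT =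
    let ⊢B' = TrType-typed w dB tΓ tB
        T₀ , tT₀ = TypeTr-of-type (var w x)
    in retype (LiftsClosed-∷ (TrCtx-lifts w tΓ) ⊢B') (LTy.weak (soundness-var w tΓ x tT₀) ⊢B')
              (TypeTr-weaken dB tT₀) tT

  soundness-Π rl dA dB tΓ lift trA trB =
    let ⊢A' = soundness dA tΓ lift trA (univ refl)
        lift₂ = LiftsClosed-∷ lift (⊢El lift ⊢A')
        ⊢B' = soundness dB (typed (⊩⇒⊢ dA) trA ∷ tΓ) lift₂ trB (univ refl)
    in ⊢Π̇ lift rl ⊢A' ⊢B' , ⊢Π-El lift ⊢A' ⊢B'

  TypeTr-typed dT tΓ lift (el dT₁ tr) with sort-unique dT dT₁
  ... | refl = ⊢El lift (soundness dT tΓ lift tr (univ refl))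
  TypeTr-typed dT tΓ lift (univ refl) = lift refl refl ⊢U

  TrType-typed w dA tΓ tA = TypeTr-typed dA tΓ (TrCtx-lifts w tΓ) (TrType⇒TypeTr tA)

  TrCtx-lifts []       []        _ _ d = d
  TrCtx-lifts (w ∷ dA) (tA ∷ tΓ) = LiftsClosed-∷ (TrCtx-lifts w tΓ) (TrType-typed w dA tΓ tA)

proposition3 : (S : Set) (Ax : S → S → Set) (Rl : S → S → S → Set) →
    let open PTS S Ax Rl in
    Functional →
    ∀ {Γ t B} → Γ ⊢ t ∶ B →
    ∀ {Γ' t' B'} → TrCtx Γ Γ' → Tr Γ t t' → TrType Γ B B' →
    Γ' ⊢λΠ t' ∶ B'
proposition3 S Ax Rl functional D tΓ tr tB =
  soundness ⊩D tΓ (TrCtx-lifts (⊩-wf ⊩D) tΓ) tr (TrType⇒TypeTr tB)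
  where
  open Metatheory S Ax Rl
  open Soundness S Ax Rl functional
  open Translation S Ax Rl functional using (TrType⇒TypeTr)
  ⊩D = ⊢⇒⊩ D
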